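{- Let $p_1=2<p_2=3<p_3=5<p_4<\cdots$ be the sequence of all primes. Then: (1) for every $l\geq 3$, all positive integers $r_4,\dots,r_l$ and every integer $\alpha\geq 3$, the number $2^{\alpha}\cdot 3\cdot 5\cdot p_4^{r_4}p_5^{r_5}\cdots p_l^{r_l}$ is $3$-layered; (2) for every $l\geq 4$, all positive integers $\beta,r_5,\dots,r_l$ and every odd integer $\alpha\geq 5$, the number $2^{\alpha}\cdot 3\cdot 5^{\beta}\cdot 7\cdot p_5^{r_5}p_6^{r_6}\cdots p_l^{r_l}$ is $3$-layered.
   Context: For a positive integer $k$, a positive integer $n$ is $k$-layered if the set of its positive divisors can be partitioned into $k$ disjoint subsets all having the same sum. -}

module Defs where

open import Data.Nat using (ℕ; zero; suc; _+_; _*_; _^_; _≤_; _<_)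
open import Data.Nat.Divisibility using (_∣_; _∣?_)
open import Data.Nat.Primality using (Prime; prime?)
open import Data.Fin using (Fin)
open import Data.List using (List; filter; map; upTo; length)
open import Data.Nat.ListAction using (sum)
open import Relation.Binary.PropositionalEquality using (_≡_)
open import Relation.Nullary.Decidable using (⌊_⌋)
open import Data.Bool using (Bool)

divisors : ℕ → List ℕ
divisors n = filter (λ d → d ∣? n) (map suc (upTo n))

primesBelow : ℕ → ℕ
primesBelow n = length (filter prime? (upTo n))

-- p is the i-th prime (1-indexed): p₁ = 2, p₂ = 3, p₃ = 5, ...
IsNthPrime : ℕ → ℕ → Set
IsNthPrime i p = Prime p × (suc (primesBelow p) ≡ i)
  where open import Data.Product using (_×_)

classSum : (k : ℕ) → (ℕ → Fin k) → Fin k → ℕ → ℕ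
classSum k c j n = sum (filter (λ d → c d Data.Fin.≟ j) (divisors n))
  where import Data.Fin

-- A partition is given by a colouring
-- c assigning each divisor one of k classes; all class sums are equal.
Layered : ℕ → ℕ → Set
Layered k n = Σ (ℕ → Fin k) λ c → ∀ i j → classSum k c i n ≡ classSum k c j n
  where open import Data.Product using (Σ)

primeProd : (ℕ → ℕ) → (ℕ → ℕ) → ℕ → ℕ → ℕ
primeProd p r a zero = 1
primeProd p r a (suc m) = p a ^ r a * primeProd p r (suc a) m

module Submission where

-- Proof idea.  Both numbers have the form  n = 2^α · a · M  with a = 15
-- (resp. a = 21) and M coprime to 2a (M = ∏ p_i^{r_i}, resp. 5^β ∏ p_i^{r_i}).
--
-- (1) Divisors of a product of coprime numbers A·B are exactly the products
--     d·e with d ∣ A, e ∣ B, each obtained once (d = gcd x A, e = gcd x B).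
--     Hence a colouring of the divisors of A lifts to A·B via x ↦ c (gcd x A),
--     and every class sum is multiplied by σ(B): k-layeredness passes to
--     A·B for B coprime to A.  So it suffices to show that 2^α·15 resp.
--     2^α·21 is 3-layered.
-- (2) The divisors of 2^α·a are the 2^i·u with i ≤ α and u ∣ a.  We colour
--     2^i·u by a colour table τ i u depending on a "band" of the exponent i;
--     a class sum is then Σ_{i≤α} 2^i · (row sum of band i), and for the two
--     explicit tables below all three class sums agree, by a geometric-series
--     computation and a polynomial identity per colour.
-- (3) The primes p_i with i ≥ 4 (resp. i ≥ 5) exceed 5 (resp. 7), so the
--     tail products are coprime to 2^α·15 (resp. 2^α·21).

open import Defs
open import Data.Nat using (ℕ; _+_; _*_; _^_; _≤_; _∸_)
open import Data.Product using (_×_)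
open import Data.Nat using (_%_)
open import Relation.Binary.PropositionalEquality using (_≡_)

open import Data.Nat hiding (_≟_)
import Data.Nat as Nat
open import Data.Nat.Properties hiding (_≟_)
open import Data.Nat.Divisibility
open import Data.Nat.GCD using (gcd; GCD; gcd-GCD; gcd[m,n]∣m; gcd[m,n]∣n; gcd-greatest; c*gcd[m,n]≡gcd[cm,cn])
open import Data.Nat.Coprimality using (Coprime; coprime-divisor; gcd≡1⇒coprime; prime⇒coprime)
  renaming (sym to coprime-sym)
open import Data.Nat.Primality using (Prime; prime?; prime⇒nonZero)
open import Data.Nat.Logarithm using (⌊log₂_⌋; ⌊log₂[2^n]⌋≡n)
open import Data.Nat.ListAction using (sum)
open import Data.Nat.ListAction.Properties using (sum-↭; sum-++)
open import Data.Nat.Tactic.RingSolver using (solve-∀)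
open import Data.List using (List; []; _∷_; _++_; map; filter; upTo; downFrom; concatMap)
open import Data.List.Properties using (map-++; map-∘; map-id)
open import Data.List.Membership.Propositional using (_∈_; lose; find)
open import Data.List.Membership.Propositional.Properties
  using (∈-filter⁻; ∈-filter⁺; ∈-map⁻; ∈-map⁺; ∈-upTo⁺; ∈-concatMap⁻; ∈-concatMap⁺; ∈-downFrom⁻; ∈-downFrom⁺)
open import Data.List.Relation.Unary.Any using (here; there)
open import Data.List.Relation.Unary.All as All using (All; []; _∷_)
open import Data.List.Relation.Unary.AllPairs using ([]; _∷_)
open import Data.List.Relation.Unary.Unique.Propositional using (Unique)
import Data.List.Relation.Unary.Unique.Propositional.Properties as Unique
import Data.List.Membership.Setoid.Properties as SetoidMembership
open import Data.List.Relation.Binary.BagAndSetEquality using (∼bag⇒↭)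
open import Data.List.Relation.Binary.Permutation.Propositional using (_↭_; ↭-sym)
import Data.List.Relation.Binary.Permutation.Propositional.Properties as Perm
open import Data.Fin as Fin using (Fin)
open import Data.Bool using (true; false; if_then_else_)
open import Data.Product using (∃; _,_; proj₁; proj₂)
open import Data.Sum using (_⊎_; inj₁; inj₂)
open import Data.Empty using (⊥-elim)
open import Data.Unit using (tt)
open import Function.Bundles using (Equivalence; _⇔_; mk⇔)
open import Relation.Binary.PropositionalEquality
open import Relation.Nullary using (¬_; Dec; yes; no)
open import Relation.Nullary.Decidable using (dec-true; dec-false; toWitnessFalse)

select : {P : Set} → Dec P → ℕ → ℕ
select (yes _) x = x
select (no _)  _ = 0

select-*ˡ : {P : Set} (P? : Dec P) (d x : ℕ) → select P? (d * x) ≡ d * select P? x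
select-*ˡ (yes _) d x = refl
select-*ˡ (no _)  d x = sym (*-zeroʳ d)

select-*ʳ : {P : Set} (P? : Dec P) (x e : ℕ) → select P? (x * e) ≡ select P? x * e
select-*ʳ (yes _) x e = refl
select-*ʳ (no _)  x e = refl

sum-filter : {P : ℕ → Set} (P? : ∀ x → Dec (P x)) (xs : List ℕ) →
  sum (filter P? xs) ≡ sum (map (λ x → select (P? x) x) xs)
sum-filter P? [] = refl
sum-filter P? (x ∷ xs) with P? x
... | yes _ = cong (x +_) (sum-filter P? xs)
... | no _  = sum-filter P? xs

sum-map-cong : {A : Set} (xs : List A) {f g : A → ℕ} → (∀ x → x ∈ xs → f x ≡ g x) →
  sum (map f xs) ≡ sum (map g xs)
sum-map-cong [] f≡g = refl
sum-map-cong (x ∷ xs) f≡g = cong₂ _+_ (f≡g x (here refl)) (sum-map-cong xs (λ y y∈ → f≡g y (there y∈)))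

sum-map-*ˡ : {A : Set} (xs : List A) (k : ℕ) (f : A → ℕ) →
  sum (map (λ x → k * f x) xs) ≡ k * sum (map f xs)
sum-map-*ˡ [] k f = sym (*-zeroʳ k)
sum-map-*ˡ (x ∷ xs) k f = trans (cong (k * f x +_) (sum-map-*ˡ xs k f)) (sym (*-distribˡ-+ k (f x) _))

sum-map-*ʳ : {A : Set} (xs : List A) (k : ℕ) (f : A → ℕ) →
  sum (map (λ x → f x * k) xs) ≡ sum (map f xs) * k
sum-map-*ʳ xs k f = begin
  sum (map (λ x → f x * k) xs) ≡⟨ sum-map-cong xs (λ x _ → *-comm (f x) k) ⟩
  sum (map (λ x → k * f x) xs) ≡⟨ sum-map-*ˡ xs k f ⟩
  k * sum (map f xs)           ≡⟨ *-comm k _ ⟩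
  sum (map f xs) * k           ∎
  where open ≡-Reasoning

sum-concatMap : {A : Set} (F : ℕ → ℕ) (g : A → List ℕ) (xs : List A) →
  sum (map F (concatMap g xs)) ≡ sum (map (λ a → sum (map F (g a))) xs)
sum-concatMap F g [] = refl
sum-concatMap F g (x ∷ xs) = begin
  sum (map F (g x ++ concatMap g xs))              ≡⟨ cong sum (map-++ F (g x) _) ⟩
  sum (map F (g x) ++ map F (concatMap g xs))      ≡⟨ sum-++ (map F (g x)) _ ⟩
  sum (map F (g x)) + sum (map F (concatMap g xs)) ≡⟨ cong (sum (map F (g x)) +_) (sum-concatMap F g xs) ⟩
  sum (map F (g x)) + sum (map (λ a → sum (map F (g a))) xs) ∎
  where open ≡-Reasoning

unique-↭ : {xs ys : List ℕ} → Unique xs → Unique ys → (∀ {x} → x ∈ xs ⇔ x ∈ ys) → xs ↭ ys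
unique-↭ xs! ys! same = ∼bag⇒↭ (λ {x} → record
  { to       = Equivalence.to (same {x})
  ; from     = Equivalence.from (same {x})
  ; to-cong  = cong (Equivalence.to (same {x}))
  ; from-cong = cong (Equivalence.from (same {x}))
  ; inverse  = (λ _ → SetoidMembership.unique⇒irrelevant (setoid ℕ) ≡-irrelevant ys! _ _)
               , (λ _ → SetoidMembership.unique⇒irrelevant (setoid ℕ) ≡-irrelevant xs! _ _) })

divisors-unique : ∀ n → Unique (divisors n)
divisors-unique n = Unique.filter⁺ (_∣? n) (Unique.map⁺ suc-injective (Unique.upTo⁺ n))

∈-divisors⁻ : ∀ {n x} → x ∈ divisors n → NonZero x × x ∣ n
∈-divisors⁻ {n} x∈ with ∈-filter⁻ (_∣? n) {xs = map suc (upTo n)} x∈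
... | x∈suc , x∣n with ∈-map⁻ suc x∈suc
... | _ , _ , refl = _ , x∣n

∈-divisors⁺ : ∀ {n x} → .{{NonZero n}} → NonZero x → x ∣ n → x ∈ divisors n
∈-divisors⁺ {n} {suc _} _ x∣n = ∈-filter⁺ (_∣? n) (∈-map⁺ suc (∈-upTo⁺ (∣⇒≤ x∣n))) x∣n

divisor-nonZero : ∀ {d n} → .{{NonZero n}} → d ∣ n → NonZero d
divisor-nonZero {zero} {n} d∣n = ⊥-elim (≢-nonZero⁻¹ n (0∣⇒≡0 d∣n))
divisor-nonZero {suc d} _ = _

coprime-∣ : ∀ {A B d e} → Coprime A B → d ∣ A → e ∣ B → Coprime d e
coprime-∣ cop d∣A e∣B (i∣d , i∣e) = cop (∣-trans i∣d d∣A , ∣-trans i∣e e∣B)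

coprime-*ʳ : ∀ {a b c} → Coprime a b → Coprime a c → Coprime a (b * c)
coprime-*ʳ {a} {b} {c} a⊥b a⊥c {k} (k∣a , k∣bc) = a⊥c (k∣a , coprime-divisor k⊥b k∣bc)
  where
  k⊥b : Coprime k b
  k⊥b (i∣k , i∣b) = a⊥b (∣-trans i∣k k∣a , i∣b)

coprime-^ʳ : ∀ {a b} n → Coprime a b → Coprime a (b ^ n)
coprime-^ʳ zero    _   (_ , i∣1) = ∣1⇒≡1 i∣1
coprime-^ʳ (suc n) a⊥b = coprime-*ʳ a⊥b (coprime-^ʳ n a⊥b)

coprime-factorisation : ∀ {A B x} → Coprime A B → x ∣ A * B → x ≡ gcd x A * gcd x B
coprime-factorisation {A} {B} {x} cop x∣AB = ∣-antisym x∣dh dh∣x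
  where
  d h q : ℕ
  d = gcd x A
  h = gcd x B
  q = quotient (gcd[m,n]∣m x A)
  x≡qd : x ≡ q * d
  x≡qd = _∣_.equality (gcd[m,n]∣m x A)
  h∣q : h ∣ q
  h∣q = coprime-divisor (coprime-sym (coprime-∣ cop (gcd[m,n]∣n x A) (gcd[m,n]∣n x B)))
          (subst (h ∣_) (trans x≡qd (*-comm q d)) (gcd[m,n]∣m x B))
  dh∣x : d * h ∣ x
  dh∣x = subst (d * h ∣_) (trans (*-comm d q) (sym x≡qd)) (*-monoʳ-∣ d h∣q)
  x∣dB : x ∣ d * B
  x∣dB = subst (x ∣_) (trans (sym (c*gcd[m,n]≡gcd[cm,cn] B x A)) (*-comm B d))
           (gcd-greatest (n∣m*n B) (subst (x ∣_) (*-comm A B) x∣AB))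
  x∣dh : x ∣ d * h
  x∣dh = subst (x ∣_) (sym (c*gcd[m,n]≡gcd[cm,cn] d x B)) (gcd-greatest (n∣m*n d) x∣dB)

gcd-coprime-product : ∀ {A B d e} → Coprime A B → d ∣ A → e ∣ B → gcd (d * e) A ≡ d
gcd-coprime-product {A} {B} {d} {e} cop d∣A e∣B = GCD.unique (gcd-GCD (d * e) A) isGCD
  where
  isGCD : GCD (d * e) A d
  isGCD = GCD.is (m∣m*n e , d∣A) λ {k} (k∣de , k∣A) →
    coprime-divisor (coprime-∣ cop k∣A e∣B) (subst (k ∣_) (*-comm d e) k∣de)

divisorProducts : ℕ → ℕ → List ℕ
divisorProducts A B = concatMap (λ d → map (d *_) (divisors B)) (divisors A)

module _ {A B : ℕ} .{{_ : NonZero A}} .{{_ : NonZero B}} (cop : Coprime A B) where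

  -- Distinct pairs (d, e) give distinct products: d is recovered as gcd (d·e) A.
  divisorProducts-unique : Unique (divisorProducts A B)
  divisorProducts-unique = go (divisors A) (divisors-unique A) (All.tabulate (∈-divisors⁻ {A}))
    where
    row : ℕ → List ℕ
    row d = map (d *_) (divisors B)
    go : ∀ ds → Unique ds → All (λ d → NonZero d × d ∣ A) ds → Unique (concatMap row ds)
    go [] _ _ = []
    go (d ∷ ds) (d∉ds ∷ ds!) ((d≢0 , d∣A) ∷ ds∣A) =
      Unique.++⁺ (Unique.map⁺ (*-cancelˡ-≡ _ _ d {{d≢0}}) (divisors-unique B)) (go ds ds! ds∣A) disjoint
      where
      disjoint : ∀ {v} → ¬ (v ∈ row d × v ∈ concatMap row ds)
      disjoint (v∈row , v∈rest) with ∈-map⁻ (d *_) v∈row | find (∈-concatMap⁻ row {xs = ds} v∈rest)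
      ... | e , e∈ , refl | d′ , d′∈ , v∈row′ with ∈-map⁻ (d′ *_) v∈row′
      ... | e′ , e′∈ , de≡d′e′ = All.lookup d∉ds d′∈ (begin
        d              ≡⟨ sym (gcd-coprime-product cop d∣A (proj₂ (∈-divisors⁻ e∈))) ⟩
        gcd (d * e) A  ≡⟨ cong (λ v → gcd v A) de≡d′e′ ⟩
        gcd (d′ * e′) A ≡⟨ gcd-coprime-product cop (proj₂ (All.lookup ds∣A d′∈)) (proj₂ (∈-divisors⁻ {B} e′∈)) ⟩
        d′             ∎)
        where open ≡-Reasoning

  instance
    AB≢0 : NonZero (A * B)
    AB≢0 = m*n≢0 A B

  divisorProducts-↭ : divisorProducts A B ↭ divisors (A * B)
  divisorProducts-↭ = unique-↭ divisorProducts-unique (divisors-unique (A * B)) (mk⇔ sound complete)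
    where
    sound : ∀ {x} → x ∈ divisorProducts A B → x ∈ divisors (A * B)
    sound x∈ with find (∈-concatMap⁻ (λ d → map (d *_) (divisors B)) {xs = divisors A} x∈)
    ... | d , d∈ , x∈row with ∈-map⁻ (d *_) x∈row
    ... | e , e∈ , refl with ∈-divisors⁻ {A} d∈ | ∈-divisors⁻ {B} e∈
    ... | d≢0 , d∣A | e≢0 , e∣B = ∈-divisors⁺ {A * B} (m*n≢0 d e {{d≢0}} {{e≢0}}) (*-pres-∣ d∣A e∣B)
    complete : ∀ {x} → x ∈ divisors (A * B) → x ∈ divisorProducts A B
    complete {x} x∈ with ∈-divisors⁻ {A * B} x∈
    ... | x≢0 , x∣AB = ∈-concatMap⁺ (λ d → map (d *_) (divisors B)) (lose d∈ x∈row)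
      where
      instance
        x≢0′ : NonZero x
        x≢0′ = x≢0
      d∈ : gcd x A ∈ divisors A
      d∈ = ∈-divisors⁺ {A} (divisor-nonZero {n = x} (gcd[m,n]∣m x A)) (gcd[m,n]∣n x A)
      e∈ : gcd x B ∈ divisors B
      e∈ = ∈-divisors⁺ {B} (divisor-nonZero {n = x} (gcd[m,n]∣m x B)) (gcd[m,n]∣n x B)
      x∈row : x ∈ map (gcd x A *_) (divisors B)
      x∈row = subst (_∈ map (gcd x A *_) (divisors B)) (sym (coprime-factorisation cop x∣AB)) (∈-map⁺ (gcd x A *_) e∈)

  sum-divisors-coprime : (F : ℕ → ℕ) →
    sum (map F (divisors (A * B))) ≡ sum (map (λ d → sum (map (λ e → F (d * e)) (divisors B))) (divisors A))
  sum-divisors-coprime F = begin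
    sum (map F (divisors (A * B)))      ≡⟨ sum-↭ (Perm.map⁺ F (↭-sym divisorProducts-↭)) ⟩
    sum (map F (divisorProducts A B))   ≡⟨ sum-concatMap F _ (divisors A) ⟩
    sum (map (λ d → sum (map F (map (d *_) (divisors B)))) (divisors A))
      ≡⟨ sum-map-cong (divisors A) (λ d _ → cong sum (sym (map-∘ (divisors B)))) ⟩
    sum (map (λ d → sum (map (λ e → F (d * e)) (divisors B))) (divisors A)) ∎
    where open ≡-Reasoning

classSum-coprime : ∀ {k A B} .{{_ : NonZero A}} .{{_ : NonZero B}} → Coprime A B →
  (χ : ℕ → ℕ → Fin k) (j : Fin k) →
  classSum k (λ x → χ (gcd x A) (gcd x B)) j (A * B) ≡
  sum (map (λ d → sum (map (λ e → select (χ d e Fin.≟ j) (d * e)) (divisors B))) (divisors A))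
classSum-coprime {k} {A} {B} cop χ j = begin
  classSum k colour j (A * B)
    ≡⟨ sum-filter (λ x → colour x Fin.≟ j) (divisors (A * B)) ⟩
  sum (map (λ x → select (colour x Fin.≟ j) x) (divisors (A * B)))
    ≡⟨ sum-divisors-coprime cop _ ⟩
  sum (map (λ d → sum (map (λ e → select (colour (d * e) Fin.≟ j) (d * e)) (divisors B))) (divisors A))
    ≡⟨ sum-map-cong (divisors A) (λ d d∈ → sum-map-cong (divisors B) (λ e e∈ →
         cong (λ c → select (c Fin.≟ j) (d * e)) (parts (proj₂ (∈-divisors⁻ d∈)) (proj₂ (∈-divisors⁻ e∈))))) ⟩
  sum (map (λ d → sum (map (λ e → select (χ d e Fin.≟ j) (d * e)) (divisors B))) (divisors A)) ∎
  where
  open ≡-Reasoning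
  colour : ℕ → Fin k
  colour x = χ (gcd x A) (gcd x B)
  parts : ∀ {d e} → d ∣ A → e ∣ B → colour (d * e) ≡ χ d e
  parts {d} {e} d∣A e∣B = cong₂ χ (gcd-coprime-product cop d∣A e∣B)
    (trans (cong (λ v → gcd v B) (*-comm d e)) (gcd-coprime-product (coprime-sym cop) e∣B d∣A))

-- Layeredness is preserved by coprime factors: colour x ∣ A·B by the colour of
-- gcd x A; every class sum is multiplied by σ(B).
layered-*-coprime : ∀ {k A B} .{{_ : NonZero A}} .{{_ : NonZero B}} → Coprime A B →
  Layered k A → Layered k (A * B)
layered-*-coprime {k} {A} {B} cop (c , balanced) = (λ x → c (gcd x A)) , λ i j →
  trans (scaled i) (trans (cong (_* sum (divisors B)) (balanced i j)) (sym (scaled j)))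
  where
  open ≡-Reasoning
  scaled : ∀ j → classSum k (λ x → c (gcd x A)) j (A * B) ≡ classSum k c j A * sum (divisors B)
  scaled j = begin
    classSum k (λ x → c (gcd x A)) j (A * B)
      ≡⟨ classSum-coprime cop (λ d _ → c d) j ⟩
    sum (map (λ d → sum (map (λ e → select (c d Fin.≟ j) (d * e)) (divisors B))) (divisors A))
      ≡⟨ sum-map-cong (divisors A) (λ d _ → factorOut d) ⟩
    sum (map (λ d → select (c d Fin.≟ j) d * sum (divisors B)) (divisors A))
      ≡⟨ sum-map-*ʳ (divisors A) _ _ ⟩
    sum (map (λ d → select (c d Fin.≟ j) d) (divisors A)) * sum (divisors B)
      ≡⟨ cong (_* sum (divisors B)) (sym (sum-filter (λ d → c d Fin.≟ j) (divisors A))) ⟩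
    classSum k c j A * sum (divisors B) ∎
    where
    factorOut : ∀ d → sum (map (λ e → select (c d Fin.≟ j) (d * e)) (divisors B)) ≡
                      select (c d Fin.≟ j) d * sum (divisors B)
    factorOut d = begin
      sum (map (λ e → select (c d Fin.≟ j) (d * e)) (divisors B))
        ≡⟨ sum-map-cong (divisors B) (λ e _ → select-*ʳ (c d Fin.≟ j) d e) ⟩
      sum (map (λ e → select (c d Fin.≟ j) d * e) (divisors B))
        ≡⟨ sum-map-*ˡ (divisors B) (select (c d Fin.≟ j) d) (λ e → e) ⟩
      select (c d Fin.≟ j) d * sum (map (λ e → e) (divisors B))
        ≡⟨ cong (λ s → select (c d Fin.≟ j) d * sum s) (map-id (divisors B)) ⟩
      select (c d Fin.≟ j) d * sum (divisors B) ∎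

2^-injective : ∀ {i j} → 2 ^ i ≡ 2 ^ j → i ≡ j
2^-injective {i} {j} eq = trans (sym (⌊log₂[2^n]⌋≡n i)) (trans (cong ⌊log₂_⌋ eq) (⌊log₂[2^n]⌋≡n j))

2^-mono-∣ : ∀ {i α} → i ≤ α → 2 ^ i ∣ 2 ^ α
2^-mono-∣ {i} {α} i≤α =
  subst (2 ^ i ∣_) (trans (sym (^-distribˡ-+-* 2 i (α ∸ i))) (cong (2 ^_) (m+[n∸m]≡n i≤α))) (m∣m*n _)

odd⇒coprime-2 : ∀ {x} → ¬ (2 ∣ x) → Coprime x 2
odd⇒coprime-2 {x} 2∤x {k} (k∣x , k∣2) with ∣⇒≤ k∣2 | divisor-nonZero {n = 2} k∣2
... | k≤2 | _ with k
... | 1 = refl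
... | 2 = ⊥-elim (2∤x k∣x)
odd⇒coprime-2 {x} 2∤x {k} (k∣x , k∣2) | s≤s (s≤s ()) | _ | suc (suc (suc _))

∣2^⇒2^ : ∀ α {x} → x ∣ 2 ^ α → ∃ λ i → i ≤ α × x ≡ 2 ^ i
∣2^⇒2^ zero x∣1 = 0 , z≤n , ∣1⇒≡1 x∣1
∣2^⇒2^ (suc α) {x} x∣ with 2 ∣? x
... | no 2∤x with ∣2^⇒2^ α (coprime-divisor (odd⇒coprime-2 2∤x) x∣)
...   | i , i≤α , x≡2^i = i , m≤n⇒m≤1+n i≤α , x≡2^i
∣2^⇒2^ (suc α) {x} x∣ | yes (divides y refl) with ∣2^⇒2^ α {y} (*-cancelˡ-∣ 2 (subst (_∣ 2 * 2 ^ α) (*-comm y 2) x∣))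
... | i , i≤α , y≡2^i = suc i , s≤s i≤α , trans (*-comm y 2) (cong (2 *_) y≡2^i)

2^-divisors-↭ : ∀ α → map (2 ^_) (downFrom (suc α)) ↭ divisors (2 ^ α)
2^-divisors-↭ α = unique-↭ (Unique.map⁺ 2^-injective (Unique.downFrom⁺ (suc α))) (divisors-unique (2 ^ α))
                          (mk⇔ sound complete)
  where
  sound : ∀ {x} → x ∈ map (2 ^_) (downFrom (suc α)) → x ∈ divisors (2 ^ α)
  sound x∈ with ∈-map⁻ (2 ^_) x∈
  ... | i , i∈ , refl = ∈-divisors⁺ {2 ^ α} {{m^n≢0 2 α}} (m^n≢0 2 i) (2^-mono-∣ (≤-pred (∈-downFrom⁻ i∈)))
  complete : ∀ {x} → x ∈ divisors (2 ^ α) → x ∈ map (2 ^_) (downFrom (suc α))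
  complete x∈ with ∣2^⇒2^ α (proj₂ (∈-divisors⁻ {2 ^ α} x∈))
  ... | i , i≤α , refl = ∈-map⁺ (2 ^_) (∈-downFrom⁺ (s≤s i≤α))

sumBelow : (ℕ → ℕ) → ℕ → ℕ
sumBelow f zero    = 0
sumBelow f (suc n) = f n + sumBelow f n

sumBelow-cong : ∀ {f g : ℕ → ℕ} n → (∀ i → i < n → f i ≡ g i) → sumBelow f n ≡ sumBelow g n
sumBelow-cong zero    f≡g = refl
sumBelow-cong (suc n) f≡g = cong₂ _+_ (f≡g n ≤-refl) (sumBelow-cong n (λ i i<n → f≡g i (m≤n⇒m≤1+n i<n)))

sum-downFrom : ∀ (f : ℕ → ℕ) n → sum (map f (downFrom n)) ≡ sumBelow f n
sum-downFrom f zero    = refl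
sum-downFrom f (suc n) = cong (f n +_) (sum-downFrom f n)

sum-divisors-2^ : ∀ α (F : ℕ → ℕ) → sum (map F (divisors (2 ^ α))) ≡ sumBelow (λ i → F (2 ^ i)) (suc α)
sum-divisors-2^ α F = begin
  sum (map F (divisors (2 ^ α)))                  ≡⟨ sum-↭ (Perm.map⁺ F (↭-sym (2^-divisors-↭ α))) ⟩
  sum (map F (map (2 ^_) (downFrom (suc α))))     ≡⟨ cong sum (sym (map-∘ (downFrom (suc α)))) ⟩
  sum (map (λ i → F (2 ^ i)) (downFrom (suc α)))  ≡⟨ sum-downFrom _ (suc α) ⟩
  sumBelow (λ i → F (2 ^ i)) (suc α)              ∎
  where open ≡-Reasoning

rowSum : ∀ {k} → ℕ → (ℕ → Fin k) → Fin k → ℕ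
rowSum a τ j = sum (map (λ u → select (τ u Fin.≟ j) u) (divisors a))

-- Colour the divisor 2^i·u of 2^α·a (a odd) by τ i u.  Class j then sums to
-- Σ_{i≤α} 2^i · rowSum a (τ i) j; if these weighted sums agree for all
-- classes, 2^α·a is layered.
layered-by-exponent : ∀ {k} α a .{{_ : NonZero a}} → Coprime (2 ^ α) a →
  (τ : ℕ → ℕ → Fin k) (S : ℕ) →
  (∀ j → sumBelow (λ i → 2 ^ i * rowSum a (τ i) j) (suc α) ≡ S) → Layered k (2 ^ α * a)
layered-by-exponent {k} α a cop τ S rows = colour , λ i j → trans (classSum≡S i) (sym (classSum≡S j))
  where
  instance
    2^α≢0 : NonZero (2 ^ α)
    2^α≢0 = m^n≢0 2 α
  colour : ℕ → Fin k
  colour x = τ ⌊log₂ gcd x (2 ^ α) ⌋ (gcd x a)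
  classSum≡S : ∀ j → classSum k colour j (2 ^ α * a) ≡ S
  classSum≡S j = begin
    classSum k colour j (2 ^ α * a)
      ≡⟨ classSum-coprime cop (λ d u → τ ⌊log₂ d ⌋ u) j ⟩
    sum (map (λ d → sum (map (λ u → select (τ ⌊log₂ d ⌋ u Fin.≟ j) (d * u)) (divisors a))) (divisors (2 ^ α)))
      ≡⟨ sum-divisors-2^ α _ ⟩
    sumBelow (λ i → sum (map (λ u → select (τ ⌊log₂ 2 ^ i ⌋ u Fin.≟ j) (2 ^ i * u)) (divisors a))) (suc α)
      ≡⟨ sumBelow-cong (suc α) (λ i _ → row i) ⟩
    sumBelow (λ i → 2 ^ i * rowSum a (τ i) j) (suc α)
      ≡⟨ rows j ⟩
    S ∎
    where
    open ≡-Reasoning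
    row : ∀ i → sum (map (λ u → select (τ ⌊log₂ 2 ^ i ⌋ u Fin.≟ j) (2 ^ i * u)) (divisors a)) ≡
                2 ^ i * rowSum a (τ i) j
    row i rewrite ⌊log₂[2^n]⌋≡n i =
      trans (sum-map-cong (divisors a) (λ u _ → select-*ˡ (τ i u Fin.≟ j) (2 ^ i) u))
            (sum-map-*ˡ (divisors a) (2 ^ i) (λ u → select (τ i u Fin.≟ j) u))

geometric₂ : ℕ → ℕ
geometric₂ = sumBelow (2 ^_)

2^≡geometric₂+1 : ∀ k → 2 ^ k ≡ geometric₂ k + 1
2^≡geometric₂+1 zero    = refl
2^≡geometric₂+1 (suc k) = begin
  2 * 2 ^ k                ≡⟨ cong (2 ^ k +_) (+-identityʳ (2 ^ k)) ⟩
  2 ^ k + 2 ^ k            ≡⟨ cong (2 ^ k +_) (2^≡geometric₂+1 k) ⟩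
  2 ^ k + (geometric₂ k + 1) ≡⟨ sym (+-assoc (2 ^ k) (geometric₂ k) 1) ⟩
  2 ^ k + geometric₂ k + 1 ∎
  where open ≡-Reasoning

≡ᵇ-refl : ∀ n → (n ≡ᵇ n) ≡ true
≡ᵇ-refl n = dec-true (n Nat.≟ n) refl

≢⇒≡ᵇ-false : ∀ {m n} → m ≢ n → (m ≡ᵇ n) ≡ false
≢⇒≡ᵇ-false {m} {n} m≢n = dec-false (m Nat.≟ n) m≢n

pattern C₀ = Fin.zero
pattern C₁ = Fin.suc Fin.zero
pattern C₂ = Fin.suc (Fin.suc Fin.zero)

-- First family, 2^α·15 with α = 3 + k.  The exponents 0, 1, 2 form the low
-- band, 3 ≤ i < α the middle band, and i = α the top band.
data Band₁ : Set where
  low mid top : Band₁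

lowOrMid : ℕ → Band₁
lowOrMid (suc (suc (suc _))) = mid
lowOrMid _                   = low

band₁ : ℕ → ℕ → Band₁
band₁ α i = if i ≡ᵇ α then top else lowOrMid i

band₁-top : ∀ α → band₁ α α ≡ top
band₁-top α rewrite ≡ᵇ-refl α = refl

band₁-below : ∀ {α i} → i < α → band₁ α i ≡ lowOrMid i
band₁-below {α} {i} i<α rewrite ≢⇒≡ᵇ-false (<⇒≢ i<α) = refl

-- Colours of the divisors 1, 3, 5, 15 of 15 in each band.  Per class the row
-- sums are (0, 16, 8) in the low band, (1, 15, 8) in the middle band and
-- (15, 1, 8) in the top band.
table₁ : Band₁ → ℕ → Fin 3
table₁ mid 1  = C₀
table₁ top 15 = C₀
table₁ _   3  = C₂
table₁ _   5  = C₂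
table₁ _   _  = C₁

lowOrMid-sum : ∀ (R : Band₁ → ℕ) k →
  sumBelow (λ i → 2 ^ i * R (lowOrMid i)) (3 + k) ≡ 7 * R low + 8 * geometric₂ k * R mid
lowOrMid-sum R zero    = lowBand (R low) (R mid)
  where
  lowBand : ∀ a b → 2 * 2 * a + (2 * a + (1 * a + 0)) ≡ 7 * a + 8 * 0 * b
  lowBand = solve-∀
lowOrMid-sum R (suc k) = trans (cong (2 ^ (3 + k) * R mid +_) (lowOrMid-sum R k))
                               (addMid (R low) (R mid) (2 ^ k) (geometric₂ k))
  where
  addMid : ∀ a b x g → 2 * (2 * (2 * x)) * b + (7 * a + 8 * g * b) ≡ 7 * a + 8 * (x + g) * b
  addMid = solve-∀

exponentSum₁ : ∀ (R : Band₁ → ℕ) k → let G = geometric₂ k in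
  sumBelow (λ i → 2 ^ i * R (band₁ (3 + k) i)) (4 + k) ≡ 8 * (G + 1) * R top + (7 * R low + 8 * G * R mid)
exponentSum₁ R k = cong₂ _+_ topTerm (trans (sumBelow-cong (3 + k) (λ i i<α → cong (λ b → 2 ^ i * R b) (band₁-below i<α)))
                                            (lowOrMid-sum R k))
  where
  topTerm : 2 ^ (3 + k) * R (band₁ (3 + k) (3 + k)) ≡ 8 * (geometric₂ k + 1) * R top
  topTerm = cong₂ _*_ (trans (^-distribˡ-+-* 2 3 k) (cong (8 *_) (2^≡geometric₂+1 k))) (cong R (band₁-top (3 + k)))

-- With the table above every class sum of 2^(3+k)·15 equals 8·(16·2^k - 1).
balanced₁ : ∀ j G → let row = λ b → rowSum 15 (table₁ b) j in
  8 * (G + 1) * row top + (7 * row low + 8 * G * row mid) ≡ 128 * G + 120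
balanced₁ C₀ = solve-∀
balanced₁ C₁ = solve-∀
balanced₁ C₂ = solve-∀

layered-2^*15 : ∀ α → 3 ≤ α → Layered 3 (2 ^ α * 15)
layered-2^*15 α 3≤α with m≤n⇒∃[o]m+o≡n 3≤α
... | k , refl = layered-by-exponent (3 + k) 15 (coprime-sym (coprime-^ʳ (3 + k) (gcd≡1⇒coprime refl)))
  (λ i → table₁ (band₁ (3 + k) i)) (128 * geometric₂ k + 120)
  (λ j → trans (exponentSum₁ (λ b → rowSum 15 (table₁ b) j) k) (balanced₁ j (geometric₂ k)))

-- Second family, 2^α·21 with α = 5 + 2t.  `double t` is 2t, defined by a
-- recursion that exposes the exponent two steps at a time.
double : ℕ → ℕ
double zero    = zero
double (suc t) = suc (suc (double t))

2^double : ∀ t → 2 ^ double t ≡ 4 ^ t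
2^double zero    = refl
2^double (suc t) = trans (cong (λ x → 2 * (2 * x)) (2^double t)) (quadruple (4 ^ t))
  where
  quadruple : ∀ x → 2 * (2 * x) ≡ 4 * x
  quadruple = solve-∀

2^[n+double] : ∀ n t → 2 ^ (n + double t) ≡ 2 ^ n * 4 ^ t
2^[n+double] n t = trans (^-distribˡ-+-* 2 n (double t)) (cong (2 ^ n *_) (2^double t))

geometric₄ : ℕ → ℕ
geometric₄ = sumBelow (4 ^_)

4^≡3geometric₄+1 : ∀ t → 4 ^ t ≡ 3 * geometric₄ t + 1
4^≡3geometric₄+1 zero    = refl
4^≡3geometric₄+1 (suc t) = begin
  4 * 4 ^ t                         ≡⟨ split (4 ^ t) ⟩
  3 * 4 ^ t + 4 ^ t                 ≡⟨ cong (3 * 4 ^ t +_) (4^≡3geometric₄+1 t) ⟩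
  3 * 4 ^ t + (3 * geometric₄ t + 1) ≡⟨ regroup (4 ^ t) (geometric₄ t) ⟩
  3 * (4 ^ t + geometric₄ t) + 1    ∎
  where
  open ≡-Reasoning
  split : ∀ x → 4 * x ≡ 3 * x + x
  split = solve-∀
  regroup : ∀ x q → 3 * x + (3 * q + 1) ≡ 3 * (x + q) + 1
  regroup = solve-∀

-- Exponent bands for 2^α·21: the two lowest exponents, the even and the odd
-- exponents 2 ≤ i ≤ α - 3, and the three top exponents α - 2, α - 1, α.
data Band₂ : Set where
  bottom₀ bottom₁ even odd top₂ top₁ top₀ : Band₂

parityBand : ℕ → Band₂
parityBand zero          = even
parityBand (suc zero)    = odd
parityBand (suc (suc n)) = parityBand n

parityBand-double : ∀ t → parityBand (double t) ≡ even
parityBand-double zero    = refl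
parityBand-double (suc t) = parityBand-double t

parityBand-suc-double : ∀ t → parityBand (suc (double t)) ≡ odd
parityBand-suc-double zero    = refl
parityBand-suc-double (suc t) = parityBand-suc-double t

lowBand₂ : ℕ → Band₂
lowBand₂ zero          = bottom₀
lowBand₂ (suc zero)    = bottom₁
lowBand₂ (suc (suc n)) = parityBand n

band₂ : ℕ → ℕ → Band₂
band₂ α i =
  if i ≡ᵇ α then top₀ else if suc i ≡ᵇ α then top₁ else if suc (suc i) ≡ᵇ α then top₂ else lowBand₂ i

band₂-top₀ : ∀ i → band₂ i i ≡ top₀
band₂-top₀ i rewrite ≡ᵇ-refl i = refl

band₂-top₁ : ∀ i → band₂ (suc i) i ≡ top₁
band₂-top₁ i rewrite ≢⇒≡ᵇ-false (<⇒≢ (n<1+n i)) | ≡ᵇ-refl (suc i) = refl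

band₂-top₂ : ∀ i → band₂ (suc (suc i)) i ≡ top₂
band₂-top₂ i rewrite ≢⇒≡ᵇ-false (<⇒≢ (<-trans (n<1+n i) (n<1+n (suc i))))
                   | ≢⇒≡ᵇ-false (<⇒≢ (n<1+n (suc i))) | ≡ᵇ-refl (suc (suc i)) = refl

band₂-low : ∀ {α i} → 3 + i ≤ α → band₂ α i ≡ lowBand₂ i
band₂-low {α} {i} 3+i≤α
  rewrite ≢⇒≡ᵇ-false (<⇒≢ (≤-trans (n≤1+n _) (≤-trans (n≤1+n _) 3+i≤α)))
        | ≢⇒≡ᵇ-false (<⇒≢ (≤-trans (n≤1+n _) 3+i≤α))
        | ≢⇒≡ᵇ-false (<⇒≢ 3+i≤α) = refl

lowBand₂-sum : ∀ (R : Band₂ → ℕ) t → let Q = geometric₄ t in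
  sumBelow (λ i → 2 ^ i * R (lowBand₂ i)) (3 + double t) ≡
  R bottom₀ + 2 * R bottom₁ + 4 * (4 ^ t + Q) * R even + 8 * Q * R odd
lowBand₂-sum R zero = bottom (R bottom₀) (R bottom₁) (R even) (R odd)
  where
  bottom : ∀ a b c d → 2 * 2 * c + (2 * b + (1 * a + 0)) ≡ a + 2 * b + 4 * (1 + 0) * c + 8 * 0 * d
  bottom = solve-∀
lowBand₂-sum R (suc t) = begin
  2 ^ (4 + double t) * R (parityBand (double t)) +
    (2 ^ (3 + double t) * R (parityBand (suc (double t))) + sumBelow f (3 + double t))
    ≡⟨ cong₂ _+_ (cong₂ _*_ (2^[n+double] 4 t) (cong R (parityBand-double t)))
                 (cong₂ _+_ (cong₂ _*_ (2^[n+double] 3 t) (cong R (parityBand-suc-double t)))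
                            (lowBand₂-sum R t)) ⟩
  16 * y * R even + (8 * y * R odd +
    (R bottom₀ + 2 * R bottom₁ + 4 * (y + Q) * R even + 8 * Q * R odd))
    ≡⟨ addPair (R bottom₀) (R bottom₁) (R even) (R odd) y Q ⟩
  R bottom₀ + 2 * R bottom₁ + 4 * (4 * y + (y + Q)) * R even + 8 * (y + Q) * R odd ∎
  where
  open ≡-Reasoning
  f : ℕ → ℕ
  f i = 2 ^ i * R (lowBand₂ i)
  y Q : ℕ
  y = 4 ^ t
  Q = geometric₄ t
  addPair : ∀ a b c d y q →
    16 * y * c + (8 * y * d + (a + 2 * b + 4 * (y + q) * c + 8 * q * d)) ≡
    a + 2 * b + 4 * (4 * y + (y + q)) * c + 8 * (y + q) * d
  addPair = solve-∀

weightedSum₂ : (Band₂ → ℕ) → ℕ → ℕ → ℕ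
weightedSum₂ R y Q = 32 * y * R top₀ + (16 * y * R top₁ + (8 * y * R top₂ +
  (R bottom₀ + 2 * R bottom₁ + 4 * (y + Q) * R even + 8 * Q * R odd)))

exponentSum₂ : ∀ (R : Band₂ → ℕ) t →
  sumBelow (λ i → 2 ^ i * R (band₂ (5 + double t) i)) (6 + double t) ≡ weightedSum₂ R (4 ^ t) (geometric₄ t)
exponentSum₂ R t =
  cong₂ _+_ (topTerm 5 (band₂-top₀ (5 + double t)))
    (cong₂ _+_ (topTerm 4 (band₂-top₁ (4 + double t)))
      (cong₂ _+_ (topTerm 3 (band₂-top₂ (3 + double t)))
        (trans (sumBelow-cong (3 + double t) (λ i i< → cong (λ b → 2 ^ i * R b) (band₂-low (+-monoʳ-≤ 2 i<))))
               (lowBand₂-sum R t))))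
  where
  topTerm : ∀ n {b} → band₂ (5 + double t) (n + double t) ≡ b →
            2 ^ (n + double t) * R (band₂ (5 + double t) (n + double t)) ≡ 2 ^ n * 4 ^ t * R b
  topTerm n eq = cong₂ _*_ (2^[n+double] n t) (cong R eq)

-- Per class the row
-- sums are (32, 0, 0) for bottom₀ and even, (28, 0, 4) for bottom₁,
-- (21, 4, 7) for odd, (11, 21, 0) for top₀, (1, 0, 31) for top₁ and
-- (11, 0, 21) for top₂.
table₂ : Band₂ → ℕ → Fin 3
table₂ bottom₁ 1  = C₂
table₂ bottom₁ 3  = C₂
table₂ odd     1  = C₁
table₂ odd     3  = C₁
table₂ odd     7  = C₂
table₂ top₀    u  = if u ≡ᵇ 21 then C₁ else C₀
table₂ top₁    1  = C₀
table₂ top₁    _  = C₂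
table₂ top₂    u  = if u ≡ᵇ 21 then C₂ else C₀
table₂ _       _  = C₀

-- With 4^t = 3Q + 1 every class sum of 2^(5+2t)·21 equals 32·(64Q + 21); the
-- left-hand side is weightedSum₂ row (3Q + 1) Q, written out for the solver.
balanced₂ : ∀ j Q → let row = λ b → rowSum 21 (table₂ b) j; y = 3 * Q + 1 in
  32 * y * row top₀ + (16 * y * row top₁ + (8 * y * row top₂ +
    (row bottom₀ + 2 * row bottom₁ + 4 * (y + Q) * row even + 8 * Q * row odd))) ≡ 2048 * Q + 672
balanced₂ C₀ = solve-∀
balanced₂ C₁ = solve-∀
balanced₂ C₂ = solve-∀

layered-2^*21 : ∀ t → Layered 3 (2 ^ (5 + double t) * 21)
layered-2^*21 t = layered-by-exponent (5 + double t) 21 (coprime-sym (coprime-^ʳ (5 + double t) (gcd≡1⇒coprime refl)))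
  (λ i → table₂ (band₂ (5 + double t) i)) (2048 * geometric₄ t + 672)
  (λ j → let R = λ b → rowSum 21 (table₂ b) j in begin
    sumBelow (λ i → 2 ^ i * R (band₂ (5 + double t) i)) (6 + double t) ≡⟨ exponentSum₂ R t ⟩
    weightedSum₂ R (4 ^ t) (geometric₄ t)                              ≡⟨ cong (λ y → weightedSum₂ R y (geometric₄ t)) (4^≡3geometric₄+1 t) ⟩
    weightedSum₂ R (3 * geometric₄ t + 1) (geometric₄ t)               ≡⟨ balanced₂ j (geometric₄ t) ⟩
    2048 * geometric₄ t + 672                                          ∎)
  where open ≡-Reasoning

double-or-suc-double : ∀ n → ∃ λ t → n ≡ double t ⊎ n ≡ suc (double t)
double-or-suc-double zero = 0 , inj₁ refl
double-or-suc-double (suc n) with double-or-suc-double n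
... | t , inj₁ refl = t , inj₂ refl
... | t , inj₂ refl = suc t , inj₁ refl

double%2≡0 : ∀ t → double t % 2 ≡ 0
double%2≡0 zero    = refl
double%2≡0 (suc t) = double%2≡0 t

odd≥5⇒5+double : ∀ α → α % 2 ≡ 1 → 5 ≤ α → ∃ λ t → α ≡ 5 + double t
odd≥5⇒5+double α α-odd 5≤α with double-or-suc-double α
... | t , inj₁ refl           = ⊥-elim (0≢1+n (trans (sym (double%2≡0 t)) α-odd))
... | suc (suc t) , inj₂ refl = t , refl
odd≥5⇒5+double α α-odd (s≤s ()) | zero , inj₂ refl
odd≥5⇒5+double α α-odd (s≤s (s≤s (s≤s ()))) | suc zero , inj₂ refl

¬prime-4 : ¬ Prime 4
¬prime-4 = toWitnessFalse {a? = prime? 4} tt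

¬prime-6 : ¬ Prime 6
¬prime-6 = toWitnessFalse {a? = prime? 6} tt

nthPrime>5 : ∀ {i q} → IsNthPrime i q → 4 ≤ i → 5 < q
nthPrime>5 {q = 0} (() , _)
nthPrime>5 {q = 1} (() , _)
nthPrime>5 {q = 2} (_ , refl) (s≤s ())
nthPrime>5 {q = 3} (_ , refl) (s≤s (s≤s ()))
nthPrime>5 {q = 4} (4-prime , _) = ⊥-elim (¬prime-4 4-prime)
nthPrime>5 {q = 5} (_ , refl) (s≤s (s≤s (s≤s ())))
nthPrime>5 {q = suc (suc (suc (suc (suc (suc _)))))} _ _ = s≤s (s≤s (s≤s (s≤s (s≤s (s≤s z≤n)))))

nthPrime>7 : ∀ {i q} → IsNthPrime i q → 5 ≤ i → 7 < q
nthPrime>7 {q = 0} (() , _)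
nthPrime>7 {q = 1} (() , _)
nthPrime>7 {q = 2} (_ , refl) (s≤s ())
nthPrime>7 {q = 3} (_ , refl) (s≤s (s≤s ()))
nthPrime>7 {q = 4} (4-prime , _) = ⊥-elim (¬prime-4 4-prime)
nthPrime>7 {q = 5} (_ , refl) (s≤s (s≤s (s≤s ())))
nthPrime>7 {q = 6} (6-prime , _) = ⊥-elim (¬prime-6 6-prime)
nthPrime>7 {q = 7} (_ , refl) (s≤s (s≤s (s≤s (s≤s ()))))
nthPrime>7 {q = suc (suc (suc (suc (suc (suc (suc (suc _)))))))} _ _ =
  s≤s (s≤s (s≤s (s≤s (s≤s (s≤s (s≤s (s≤s z≤n)))))))

primeProd-nonZero : ∀ p r a m → (∀ i → a ≤ i → NonZero (p i)) → NonZero (primeProd p r a m)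
primeProd-nonZero p r a zero    _    = _
primeProd-nonZero p r a (suc m) p≢0 =
  m*n≢0 _ _ {{m^n≢0 (p a) (r a) {{p≢0 a ≤-refl}}}}
            {{primeProd-nonZero p r (suc a) m (λ i a<i → p≢0 i (≤-trans (n≤1+n a) a<i))}}

coprime-primeProd : ∀ {n} p r a m → (∀ i → a ≤ i → Coprime n (p i)) → Coprime n (primeProd p r a m)
coprime-primeProd p r a zero    _   (_ , i∣1) = ∣1⇒≡1 i∣1
coprime-primeProd p r a (suc m) n⊥p =
  coprime-*ʳ (coprime-^ʳ (r a) (n⊥p a ≤-refl))
             (coprime-primeProd p r (suc a) m (λ i a<i → n⊥p i (≤-trans (n≤1+n a) a<i)))

coprime-2^* : ∀ α {a q} → Coprime q 2 → Coprime q a → Coprime (2 ^ α * a) q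
coprime-2^* α q⊥2 q⊥a = coprime-sym (coprime-*ʳ (coprime-^ʳ α q⊥2) q⊥a)

family₁ : (p : ℕ → ℕ) → (∀ i → 1 ≤ i → IsNthPrime i (p i)) →
  (l : ℕ) → 3 ≤ l → (r : ℕ → ℕ) → (∀ i → 4 ≤ i → i ≤ l → 1 ≤ r i) →
  (α : ℕ) → 3 ≤ α → Layered 3 (2 ^ α * 3 * 5 * primeProd p r 4 (l ∸ 3))
family₁ p nthPrime l _ r _ α 3≤α =
  subst (Layered 3) (cong (_* M) (sym (*-assoc (2 ^ α) 3 5)))
    (layered-*-coprime {{m*n≢0 (2 ^ α) 15 {{m^n≢0 2 α}}}} {{M≢0}}
      (coprime-primeProd p r 4 (l ∸ 3) tail⊥) (layered-2^*15 α 3≤α))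
  where
  M : ℕ
  M = primeProd p r 4 (l ∸ 3)
  prime : ∀ i → 4 ≤ i → Prime (p i)
  prime i 4≤i = proj₁ (nthPrime i (≤-trans (s≤s z≤n) 4≤i))
  large : ∀ i → 4 ≤ i → 5 < p i
  large i 4≤i = nthPrime>5 (nthPrime i (≤-trans (s≤s z≤n) 4≤i)) 4≤i
  M≢0 : NonZero M
  M≢0 = primeProd-nonZero p r 4 (l ∸ 3) (λ i 4≤i → prime⇒nonZero (prime i 4≤i))
  tail⊥ : ∀ i → 4 ≤ i → Coprime (2 ^ α * 15) (p i)
  tail⊥ i 4≤i = coprime-2^* α (⊥small 2 (s≤s (s≤s z≤n))) (coprime-*ʳ {b = 3} (⊥small 3 (s≤s (s≤s (s≤s z≤n)))) (⊥small 5 ≤-refl))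
    where
    ⊥small : ∀ n .{{_ : NonZero n}} → n ≤ 5 → Coprime (p i) n
    ⊥small n n≤5 = prime⇒coprime (prime i 4≤i) (≤-<-trans n≤5 (large i 4≤i))

family₂ : (p : ℕ → ℕ) → (∀ i → 1 ≤ i → IsNthPrime i (p i)) →
  (l : ℕ) → 4 ≤ l → (β : ℕ) → 1 ≤ β → (r : ℕ → ℕ) → (∀ i → 5 ≤ i → i ≤ l → 1 ≤ r i) →
  (α : ℕ) → α % 2 ≡ 1 → 5 ≤ α → Layered 3 (2 ^ α * 3 * 5 ^ β * 7 * primeProd p r 5 (l ∸ 4))
family₂ p nthPrime l _ β _ r _ α α-odd 5≤α with odd≥5⇒5+double α α-odd 5≤α
... | t , refl =
  subst (Layered 3) (regroup (2 ^ α) (5 ^ β) P)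
    (layered-*-coprime {{m*n≢0 (2 ^ α) 21 {{m^n≢0 2 α}}}} {{m*n≢0 (5 ^ β) P {{m^n≢0 5 β}} {{P≢0}}}}
      (coprime-*ʳ (coprime-^ʳ β (coprime-2^* α (gcd≡1⇒coprime refl) (gcd≡1⇒coprime refl)))
                  (coprime-primeProd p r 5 (l ∸ 4) tail⊥))
      (layered-2^*21 t))
  where
  P : ℕ
  P = primeProd p r 5 (l ∸ 4)
  regroup : ∀ x y z → x * 21 * (y * z) ≡ x * 3 * y * 7 * z
  regroup = solve-∀
  prime : ∀ i → 5 ≤ i → Prime (p i)
  prime i 5≤i = proj₁ (nthPrime i (≤-trans (s≤s z≤n) 5≤i))
  large : ∀ i → 5 ≤ i → 7 < p i
  large i 5≤i = nthPrime>7 (nthPrime i (≤-trans (s≤s z≤n) 5≤i)) 5≤i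
  P≢0 : NonZero P
  P≢0 = primeProd-nonZero p r 5 (l ∸ 4) (λ i 5≤i → prime⇒nonZero (prime i 5≤i))
  tail⊥ : ∀ i → 5 ≤ i → Coprime (2 ^ α * 21) (p i)
  tail⊥ i 5≤i = coprime-2^* α (⊥small 2 (s≤s (s≤s z≤n))) (coprime-*ʳ {b = 3} (⊥small 3 (s≤s (s≤s (s≤s z≤n)))) (⊥small 7 ≤-refl))
    where
    ⊥small : ∀ n .{{_ : NonZero n}} → n ≤ 7 → Coprime (p i) n
    ⊥small n n≤7 = prime⇒coprime (prime i 5≤i) (≤-<-trans n≤7 (large i 5≤i))

mainTheorem8 : (p : ℕ → ℕ) → (∀ i → 1 ≤ i → IsNthPrime i (p i)) →
    ((l : ℕ) → 3 ≤ l → (r : ℕ → ℕ) → (∀ i → 4 ≤ i → i ≤ l → 1 ≤ r i) →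
      (α : ℕ) → 3 ≤ α →
      Layered 3 (2 ^ α * 3 * 5 * primeProd p r 4 (l ∸ 3)))
    ×
    ((l : ℕ) → 4 ≤ l → (β : ℕ) → 1 ≤ β → (r : ℕ → ℕ) → (∀ i → 5 ≤ i → i ≤ l → 1 ≤ r i) →
      (α : ℕ) → α % 2 ≡ 1 → 5 ≤ α →
      Layered 3 (2 ^ α * 3 * 5 ^ β * 7 * primeProd p r 5 (l ∸ 4)))
mainTheorem8 p nthPrime = family₁ p nthPrime , family₂ p nthPrime
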